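{- For every $n\ge1$, $\displaystyle R_n=\sum_{i=0}^{n-1}R_i\widetilde R_{n-i}$.
   Context: Let $q\ge 4$ be an integer and consider the regular square mosaic $\{4,q\}$ (Schläfli symbol), i.e. the tiling of the Euclidean plane ($q=4$) or of the hyperbolic plane ($q\ge5$) by congruent regular squares with $q$ squares around each vertex. For $n\ge1$ the $(2\times n)$-board is defined as follows. Choose a square $S_1$ of the mosaic with vertices $A_0,A_1,B_1,B_0$ in cyclic order. Inductively, for $i\ge1$ let $S_{i+1}$ be the other square of the mosaic containing the edge $A_iB_i$, with vertices $A_i,A_{i+1},B_{i+1},B_i$ in cyclic order. The first level of the board consists of $S_1,\dots,S_n$; the second level consists of all squares of the mosaic having at least one vertex in $\{A_1,\dots,A_n\}$ and no vertex in $\{B_1,\dots,B_n,A_{n+1}\}$ (here $A_{n+1}$ is the vertex of $S_{n+1}$). The board is the union of both levels. For $1\le j\le n$ the $j$-th column consists of $S_j$ together with the second-level squares that contain $A_j$ but not $A_{j+1}$. A domino is a pair of squares of the board sharing an edge. Given positive integers $a,b$, a colored tiling is a partition of the squares of the board into single squares and dominoes, each single square receiving one of $a$ colors and each domino one of $b$ colors. A tiling is breakable in position $i$ ($1\le i\le n-1$) if no domino contains a square of the first $i$ columns and a square of the remaining columns; it is unbreakable if it is breakable in no position. $R_n$ is the number of colored tilings of the $(2\times n)$-board ($R_0=1$) and $\widetilde R_n$ the number of unbreakable colored tilings of it. -}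

module Defs where

open import Data.Nat using (ℕ; zero; suc; _+_; _*_; _∸_; _^_; _≤ᵇ_; _≡ᵇ_)
open import Data.Bool using (Bool; true; false; _∧_; _∨_; not; if_then_else_)
open import Data.List using (List; []; _∷_; _++_; map; concatMap; upTo; length)
open import Data.Nat.ListAction using (sum)
open import Data.Product using (_×_; _,_)

-- Squares of the (2×n)-board in the mosaic {4,q}, described combinatorially.
--   lo j   = S_j  (first level, column j, 1 ≤ j ≤ n)
--   hi j k = k-th second-level square of column j (0 ≤ k < q-3):
--            hi j 0 = the square on the other side of edge A_{j-1}A_j from S_j,
--            hi j 1 … hi j (q-4) = the remaining squares around A_j, in cyclic
--            order, so that hi j (q-4) shares an edge with hi (j+1) 0
--            (the square on the other side of A_jA_{j+1} from S_{j+1}).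
data Cell : Set where
  lo : ℕ → Cell
  hi : ℕ → ℕ → Cell

col : Cell → ℕ
col (lo j)   = j
col (hi j _) = j

_==_ : Cell → Cell → Bool
lo i   == lo j   = i ≡ᵇ j
hi i k == hi j l = (i ≡ᵇ j) ∧ (k ≡ᵇ l)
_      == _      = false

range1 : ℕ → List ℕ
range1 n = map suc (upTo n)

width : ℕ → ℕ
width q = q ∸ 3

cells : ℕ → ℕ → List Cell
cells q n = map lo (range1 n) ++ concatMap (λ j → map (hi j) (upTo (width q))) (range1 n)

Domino : Set
Domino = Cell × Cell

dominoes : ℕ → ℕ → List Domino
dominoes q n =
     map (λ j → (lo j , lo (suc j))) (range1 (n ∸ 1))
  ++ map (λ j → (lo j , hi j 0)) (range1 n)
  ++ concatMap (λ j → map (λ k → (hi j k , hi j (suc k))) (upTo (width q ∸ 1))) (range1 n)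
  ++ map (λ j → (hi j (width q ∸ 1) , hi (suc j) 0)) (range1 (n ∸ 1))

subsets : {A : Set} → List A → List (List A)
subsets []       = [] ∷ []
subsets (x ∷ xs) = subsets xs ++ map (x ∷_) (subsets xs)

elem : Cell → List Cell → Bool
elem c []       = false
elem c (d ∷ ds) = (c == d) ∨ elem c ds

distinct : List Cell → Bool
distinct []       = true
distinct (c ∷ cs) = not (elem c cs) ∧ distinct cs

endpoints : List Domino → List Cell
endpoints []             = []
endpoints ((u , v) ∷ ds) = u ∷ v ∷ endpoints ds

-- a set of dominoes is (the domino part of) a tiling iff the dominoes are
-- pairwise disjoint; the remaining squares are the single squares
isTiling : List Domino → Bool
isTiling ds = distinct (endpoints ds)

countB : (Cell → Bool) → List Cell → ℕ
countB p []       = 0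
countB p (c ∷ cs) = (if p c then 1 else 0) + countB p cs

singles : ℕ → ℕ → List Domino → ℕ
singles q n ds = countB (λ c → not (elem c (endpoints ds))) (cells q n)

-- number of colourings of a tiling: a^(#singles) * b^(#dominoes)
weight : ℕ → ℕ → ℕ → ℕ → List Domino → ℕ
weight q a b n ds = a ^ singles q n ds * b ^ length ds

countTilings : ℕ → ℕ → ℕ → ℕ → (List Domino → Bool) → ℕ
countTilings q a b n P =
  sum (map (λ ds → if isTiling ds ∧ P ds then weight q a b n ds else 0)
           (subsets (dominoes q n)))

crosses : ℕ → Domino → Bool
crosses i (u , v) = ((col u ≤ᵇ i) ∧ not (col v ≤ᵇ i)) ∨ ((col v ≤ᵇ i) ∧ not (col u ≤ᵇ i))

anyB : {A : Set} → (A → Bool) → List A → Bool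
anyB p []       = false
anyB p (x ∷ xs) = p x ∨ anyB p xs

allB : {A : Set} → (A → Bool) → List A → Bool
allB p []       = true
allB p (x ∷ xs) = p x ∧ allB p xs

breakable : List Domino → ℕ → Bool
breakable ds i = not (anyB (crosses i) ds)

unbreakable : ℕ → List Domino → Bool
unbreakable n ds = allB (λ i → not (breakable ds i)) (range1 (n ∸ 1))

-- R_n : number of coloured tilings of the (2×n)-board (R_0 = 1 automatically)
R : ℕ → ℕ → ℕ → ℕ → ℕ
R q a b n = countTilings q a b n (λ _ → true)

Rt : ℕ → ℕ → ℕ → ℕ → ℕ
Rt q a b n = countTilings q a b n (unbreakable n)

-- Classify the tilings of the n-board by their last breakable position i, with i = 0 when there is
-- none. Cutting such a tiling at i gives a tiling of the i-board together with an unbreakable tiling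
-- of the (n − i)-board, every such pair arises exactly once, and the number of colourings
-- a ^ #singles * b ^ #dominoes is multiplicative under the cut; summing over i gives the recurrence.
-- In the encoding a tiling is a set of pairwise disjoint dominoes: the dominoes of the (i + p)-board
-- are those of the i-board, the two dominoes straddling columns i and i + 1, and a translate of
-- those of the p-board; a domino set has its last break at i exactly when it avoids the two
-- straddling dominoes and its part to the right of column i is unbreakable.
module Submission where

open import Defs
open import Data.Nat using (ℕ; zero; suc; _+_; _*_; _∸_; _^_; _≤_; _<_; _≤ᵇ_; _<ᵇ_; _≡ᵇ_; z≤n; s≤s)
open import Data.Nat.Properties
open import Data.Bool using (Bool; true; false; _∧_; _∨_; not; if_then_else_)
open import Data.Bool.Properties using (∨-assoc; ∧-assoc; ∨-identityʳ; ∧-identityʳ; ∧-zeroʳ; ∨-zeroʳ; ∨-commutativeMonoid; ∧-commutativeMonoid)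
open import Data.List using (List; []; _∷_; _++_; _∷ʳ_; map; concatMap; upTo; applyUpTo; length)
open import Data.List.Properties using (map-++; map-∘; map-cong; map-upTo; upTo-∷ʳ; ++-assoc; concatMap-++; concatMap-map; concatMap-cong; map-concatMap; length-++; length-map)
open import Data.List.Relation.Unary.All as All using (All; []; _∷_)
open import Data.List.Relation.Unary.All.Properties using (map⁺; ++⁺; concat⁺; applyUpTo⁺₁)
open import Data.List.Relation.Binary.Permutation.Propositional as ↭ using (_↭_; ↭-refl; ↭-reflexive; ↭-trans)
open import Data.List.Relation.Binary.Permutation.Propositional.Properties using (++-commutativeMonoid; ↭-length)
open import Data.Nat.ListAction using (sum)
open import Data.Nat.ListAction.Properties using (sum-++)
open import Data.Product using (_×_; _,_; proj₁; proj₂)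
import Data.Product as Product
open import Relation.Binary.PropositionalEquality
open import Data.Empty using (⊥-elim)
open import Data.Unit using (tt)
import Algebra.Properties.CommutativeSemigroup as CommSemigroupProperties
import Algebra.Solver.CommutativeMonoid as CommMonoidSolver
open import Algebra.Bundles using (CommutativeMonoid)
open ≡-Reasoning

open CommSemigroupProperties +-commutativeSemigroup using () renaming (interchange to +-interchange; x∙yz≈y∙xz to +-leftComm)
open CommSemigroupProperties *-commutativeSemigroup using () renaming (interchange to *-interchange)
open CommSemigroupProperties (CommutativeMonoid.commutativeSemigroup ∨-commutativeMonoid) using () renaming (x∙yz≈y∙xz to ∨-leftComm)
open CommSemigroupProperties (CommutativeMonoid.commutativeSemigroup ∧-commutativeMonoid) using () renaming (x∙yz≈y∙xz to ∧-leftComm)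

-- Sums over all sub-lists

sum-map-+ : {A : Set} (f g : A → ℕ) (xs : List A) →
  sum (map (λ x → f x + g x) xs) ≡ sum (map f xs) + sum (map g xs)
sum-map-+ f g []       = refl
sum-map-+ f g (x ∷ xs) = begin
  f x + g x + sum (map (λ x → f x + g x) xs)    ≡⟨ cong (f x + g x +_) (sum-map-+ f g xs) ⟩
  f x + g x + (sum (map f xs) + sum (map g xs)) ≡⟨ +-interchange (f x) (g x) _ _ ⟩
  f x + sum (map f xs) + (g x + sum (map g xs)) ∎

sum-map-*ˡ : {A : Set} (k : ℕ) (f : A → ℕ) (xs : List A) →
  sum (map (λ x → k * f x) xs) ≡ k * sum (map f xs)
sum-map-*ˡ k f []       = sym (*-zeroʳ k)
sum-map-*ˡ k f (x ∷ xs) = trans (cong (k * f x +_) (sum-map-*ˡ k f xs)) (sym (*-distribˡ-+ k (f x) _))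

sum-map-zero : {A : Set} (xs : List A) → sum (map (λ _ → 0) xs) ≡ 0
sum-map-zero []       = refl
sum-map-zero (_ ∷ xs) = sum-map-zero xs

sum-map-swap : {A B : Set} (h : A → B → ℕ) (xs : List A) (ys : List B) →
  sum (map (λ x → sum (map (h x) ys)) xs) ≡ sum (map (λ y → sum (map (λ x → h x y) xs)) ys)
sum-map-swap h []       ys = sym (sum-map-zero ys)
sum-map-swap h (x ∷ xs) ys = begin
  sum (map (h x) ys) + sum (map (λ x → sum (map (h x) ys)) xs)
    ≡⟨ cong (sum (map (h x) ys) +_) (sum-map-swap h xs ys) ⟩
  sum (map (h x) ys) + sum (map (λ y → sum (map (λ x → h x y) xs)) ys)
    ≡⟨ sym (sum-map-+ (h x) _ ys) ⟩
  sum (map (λ y → sum (map (λ x → h x y) (x ∷ xs))) ys) ∎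

sumSubsets : {A : Set} → List A → (List A → ℕ) → ℕ
sumSubsets D g = sum (map g (subsets D))

module _ {A : Set} where

  sumSubsets-∷ : (x : A) (D : List A) (g : List A → ℕ) →
    sumSubsets (x ∷ D) g ≡ sumSubsets D g + sumSubsets D (λ s → g (x ∷ s))
  sumSubsets-∷ x D g = begin
    sum (map g (subsets D ++ map (x ∷_) (subsets D)))          ≡⟨ cong sum (map-++ g (subsets D) _) ⟩
    sum (map g (subsets D) ++ map g (map (x ∷_) (subsets D)))  ≡⟨ sum-++ (map g (subsets D)) _ ⟩
    sumSubsets D g + sum (map g (map (x ∷_) (subsets D)))      ≡⟨ cong (λ ys → sumSubsets D g + sum ys) (sym (map-∘ (subsets D))) ⟩
    sumSubsets D g + sumSubsets D (λ s → g (x ∷ s))            ∎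

  sumSubsets-cong : (D : List A) {g h : List A → ℕ} → (∀ s → g s ≡ h s) → sumSubsets D g ≡ sumSubsets D h
  sumSubsets-cong D g≗h = cong sum (map-cong g≗h (subsets D))

  sumSubsets-congᴬˡˡ : {P : A → Set} (D : List A) {g h : List A → ℕ} → All P D →
    (∀ s → All P s → g s ≡ h s) → sumSubsets D g ≡ sumSubsets D h
  sumSubsets-congᴬˡˡ []      _          g≗h = cong (_+ 0) (g≗h [] [])
  sumSubsets-congᴬˡˡ (x ∷ D) {g} {h} (px ∷ pD) g≗h = begin
    sumSubsets (x ∷ D) g                               ≡⟨ sumSubsets-∷ x D g ⟩
    sumSubsets D g + sumSubsets D (λ s → g (x ∷ s))
      ≡⟨ cong₂ _+_ (sumSubsets-congᴬˡˡ D pD g≗h) (sumSubsets-congᴬˡˡ D pD (λ s ps → g≗h (x ∷ s) (px ∷ ps))) ⟩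
    sumSubsets D h + sumSubsets D (λ s → h (x ∷ s))    ≡⟨ sym (sumSubsets-∷ x D h) ⟩
    sumSubsets (x ∷ D) h                               ∎

  sumSubsets-zero : (D : List A) {g : List A → ℕ} → (∀ s → g s ≡ 0) → sumSubsets D g ≡ 0
  sumSubsets-zero D g≗0 = trans (sumSubsets-cong D g≗0) (sum-map-zero (subsets D))

  sumSubsets-++ : (D E : List A) (g : List A → ℕ) →
    sumSubsets (D ++ E) g ≡ sumSubsets D (λ s → sumSubsets E (λ t → g (s ++ t)))
  sumSubsets-++ []      E g = sym (+-identityʳ _)
  sumSubsets-++ (x ∷ D) E g = begin
    sumSubsets (x ∷ D ++ E) g
      ≡⟨ sumSubsets-∷ x (D ++ E) g ⟩
    sumSubsets (D ++ E) g + sumSubsets (D ++ E) (λ s → g (x ∷ s))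
      ≡⟨ cong₂ _+_ (sumSubsets-++ D E g) (sumSubsets-++ D E (λ s → g (x ∷ s))) ⟩
    sumSubsets D (λ s → sumSubsets E (λ t → g (s ++ t))) + sumSubsets D (λ s → sumSubsets E (λ t → g (x ∷ s ++ t)))
      ≡⟨ sym (sumSubsets-∷ x D _) ⟩
    sumSubsets (x ∷ D) (λ s → sumSubsets E (λ t → g (s ++ t))) ∎

  sumSubsets-*ˡ : (k : ℕ) (D : List A) (g : List A → ℕ) → sumSubsets D (λ s → k * g s) ≡ k * sumSubsets D g
  sumSubsets-*ˡ k D g = sum-map-*ˡ k g (subsets D)

  sumSubsets-↭ : {D E : List A} (g : List A → ℕ) → (∀ {s t} → s ↭ t → g s ≡ g t) →
    D ↭ E → sumSubsets D g ≡ sumSubsets E g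
  sumSubsets-↭ g g-↭ ↭.refl = refl
  sumSubsets-↭ g g-↭ (↭.prep {xs = D} {ys = E} x D↭E) = begin
    sumSubsets (x ∷ D) g                            ≡⟨ sumSubsets-∷ x D g ⟩
    sumSubsets D g + sumSubsets D (λ s → g (x ∷ s))
      ≡⟨ cong₂ _+_ (sumSubsets-↭ g g-↭ D↭E) (sumSubsets-↭ (λ s → g (x ∷ s)) (λ p → g-↭ (↭.prep x p)) D↭E) ⟩
    sumSubsets E g + sumSubsets E (λ s → g (x ∷ s)) ≡⟨ sym (sumSubsets-∷ x E g) ⟩
    sumSubsets (x ∷ E) g                            ∎
  sumSubsets-↭ g g-↭ (↭.swap {xs = D} {ys = E} x y D↭E) = begin
    sumSubsets (x ∷ y ∷ D) g
      ≡⟨ trans (sumSubsets-∷ x (y ∷ D) g) (cong₂ _+_ (sumSubsets-∷ y D g) (sumSubsets-∷ y D _)) ⟩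
    (Σ D g + Σ D (λ s → g (y ∷ s))) + (Σ D (λ s → g (x ∷ s)) + Σ D (λ s → g (x ∷ y ∷ s)))
      ≡⟨ cong₂ _+_ (cong₂ _+_ (sumSubsets-↭ g g-↭ D↭E) (sumSubsets-↭ _ (λ p → g-↭ (↭.prep y p)) D↭E))
                   (cong₂ _+_ (sumSubsets-↭ _ (λ p → g-↭ (↭.prep x p)) D↭E) xy↦yx) ⟩
    (Σ E g + Σ E (λ s → g (y ∷ s))) + (Σ E (λ s → g (x ∷ s)) + Σ E (λ s → g (y ∷ x ∷ s)))
      ≡⟨ +-interchange (Σ E g) _ _ _ ⟩
    (Σ E g + Σ E (λ s → g (x ∷ s))) + (Σ E (λ s → g (y ∷ s)) + Σ E (λ s → g (y ∷ x ∷ s)))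
      ≡⟨ sym (trans (sumSubsets-∷ y (x ∷ E) g) (cong₂ _+_ (sumSubsets-∷ x E g) (sumSubsets-∷ x E _))) ⟩
    sumSubsets (y ∷ x ∷ E) g ∎
    where
    Σ = sumSubsets
    xy↦yx : Σ D (λ s → g (x ∷ y ∷ s)) ≡ Σ E (λ s → g (y ∷ x ∷ s))
    xy↦yx = trans (sumSubsets-↭ (λ s → g (x ∷ y ∷ s)) (λ p → g-↭ (↭.prep x (↭.prep y p))) D↭E)
                  (sumSubsets-cong E (λ s → g-↭ (↭.swap x y ↭-refl)))
  sumSubsets-↭ g g-↭ (↭.trans D↭E E↭F) = trans (sumSubsets-↭ g g-↭ D↭E) (sumSubsets-↭ g g-↭ E↭F)

  sumSubsets-map : {B : Set} (f : A → B) (D : List A) (g : List B → ℕ) →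
    sumSubsets (map f D) g ≡ sumSubsets D (λ s → g (map f s))
  sumSubsets-map f D g = begin
    sum (map g (subsets (map f D)))         ≡⟨ cong (λ ss → sum (map g ss)) (subsets-map D) ⟩
    sum (map g (map (map f) (subsets D)))   ≡⟨ cong sum (sym (map-∘ (subsets D))) ⟩
    sumSubsets D (λ s → g (map f s))        ∎
    where
    subsets-map : ∀ D → subsets (map f D) ≡ map (map f) (subsets D)
    subsets-map []      = refl
    subsets-map (x ∷ D) = begin
      subsets (map f D) ++ map (f x ∷_) (subsets (map f D))
        ≡⟨ cong (λ ss → ss ++ map (f x ∷_) ss) (subsets-map D) ⟩
      map (map f) (subsets D) ++ map (f x ∷_) (map (map f) (subsets D))
        ≡⟨ cong (map (map f) (subsets D) ++_) (trans (sym (map-∘ (subsets D))) (map-∘ (subsets D))) ⟩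
      map (map f) (subsets D) ++ map (map f) (map (x ∷_) (subsets D))
        ≡⟨ sym (map-++ (map f) (subsets D) _) ⟩
      map (map f) (subsets (x ∷ D)) ∎

sumSubsets-product : {A B : Set} (D : List A) (E : List B) (g : List A → ℕ) (h : List B → ℕ) →
  sumSubsets D (λ s → sumSubsets E (λ t → g s * h t)) ≡ sumSubsets D g * sumSubsets E h
sumSubsets-product D E g h = begin
  sumSubsets D (λ s → sumSubsets E (λ t → g s * h t)) ≡⟨ sumSubsets-cong D (λ s → sumSubsets-*ˡ (g s) E h) ⟩
  sumSubsets D (λ s → g s * sumSubsets E h)           ≡⟨ sumSubsets-cong D (λ s → *-comm (g s) _) ⟩
  sumSubsets D (λ s → sumSubsets E h * g s)           ≡⟨ sumSubsets-*ˡ (sumSubsets E h) D g ⟩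
  sumSubsets E h * sumSubsets D g                     ≡⟨ *-comm _ (sumSubsets D g) ⟩
  sumSubsets D g * sumSubsets E h                     ∎

module _ {A : Set} (p : A → Bool) where

  anyB-++ : ∀ xs ys → anyB p (xs ++ ys) ≡ anyB p xs ∨ anyB p ys
  anyB-++ []       ys = refl
  anyB-++ (x ∷ xs) ys = trans (cong (p x ∨_) (anyB-++ xs ys)) (sym (∨-assoc (p x) _ _))

  anyB-↭ : {xs ys : List A} → xs ↭ ys → anyB p xs ≡ anyB p ys
  anyB-↭ ↭.refl             = refl
  anyB-↭ (↭.prep x xs↭ys)   = cong (p x ∨_) (anyB-↭ xs↭ys)
  anyB-↭ (↭.swap x y xs↭ys) = trans (∨-leftComm (p x) (p y) _) (cong (λ b → p y ∨ (p x ∨ b)) (anyB-↭ xs↭ys))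
  anyB-↭ (↭.trans p₁ p₂)    = trans (anyB-↭ p₁) (anyB-↭ p₂)

  anyB-none : ∀ xs → All (λ x → p x ≡ false) xs → anyB p xs ≡ false
  anyB-none []       []           = refl
  anyB-none (x ∷ xs) (px≡f ∷ pxs) = cong₂ _∨_ px≡f (anyB-none xs pxs)

  allB-++ : ∀ xs ys → allB p (xs ++ ys) ≡ allB p xs ∧ allB p ys
  allB-++ []       ys = refl
  allB-++ (x ∷ xs) ys = trans (cong (p x ∧_) (allB-++ xs ys)) (sym (∧-assoc (p x) _ _))

  allB-∷ʳ : ∀ xs x → allB p (xs ∷ʳ x) ≡ allB p xs ∧ p x
  allB-∷ʳ xs x = trans (allB-++ xs (x ∷ [])) (cong (allB p xs ∧_) (∧-identityʳ (p x)))

anyB-map : {A B : Set} (p : B → Bool) (f : A → B) → ∀ xs → anyB p (map f xs) ≡ anyB (λ x → p (f x)) xs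
anyB-map p f []       = refl
anyB-map p f (x ∷ xs) = cong (p (f x) ∨_) (anyB-map p f xs)

anyB-cong : {A : Set} {p q : A → Bool} → (∀ x → p x ≡ q x) → ∀ xs → anyB p xs ≡ anyB q xs
anyB-cong p≗q []       = refl
anyB-cong p≗q (x ∷ xs) = cong₂ _∨_ (p≗q x) (anyB-cong p≗q xs)

allB-cong : {A : Set} {p q : A → Bool} → (∀ x → p x ≡ q x) → ∀ xs → allB p xs ≡ allB q xs
allB-cong p≗q []       = refl
allB-cong p≗q (x ∷ xs) = cong₂ _∧_ (p≗q x) (allB-cong p≗q xs)

≡ᵇ-sym : ∀ m n → (m ≡ᵇ n) ≡ (n ≡ᵇ m)
≡ᵇ-sym zero    zero    = refl
≡ᵇ-sym zero    (suc n) = refl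
≡ᵇ-sym (suc m) zero    = refl
≡ᵇ-sym (suc m) (suc n) = ≡ᵇ-sym m n

≢⇒≡ᵇ-false : ∀ {m n} → m ≢ n → (m ≡ᵇ n) ≡ false
≢⇒≡ᵇ-false {zero}  {zero}  m≢n = ⊥-elim (m≢n refl)
≢⇒≡ᵇ-false {zero}  {suc n} m≢n = refl
≢⇒≡ᵇ-false {suc m} {zero}  m≢n = refl
≢⇒≡ᵇ-false {suc m} {suc n} m≢n = ≢⇒≡ᵇ-false (λ m≡n → m≢n (cong suc m≡n))

+-cancelˡ-≡ᵇ : ∀ i m n → (i + m ≡ᵇ i + n) ≡ (m ≡ᵇ n)
+-cancelˡ-≡ᵇ zero    m n = refl
+-cancelˡ-≡ᵇ (suc i) m n = +-cancelˡ-≡ᵇ i m n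

+-cancelʳ-≡ᵇ : ∀ i m n → (m + i ≡ᵇ n + i) ≡ (m ≡ᵇ n)
+-cancelʳ-≡ᵇ i m n = trans (cong₂ _≡ᵇ_ (+-comm m i) (+-comm n i)) (+-cancelˡ-≡ᵇ i m n)

<ᵇ-suc : ∀ m n → (m <ᵇ suc n) ≡ (m ≤ᵇ n)
<ᵇ-suc zero    n = refl
<ᵇ-suc (suc m) n = refl

+-cancelˡ-≤ᵇ : ∀ i m n → (i + m ≤ᵇ i + n) ≡ (m ≤ᵇ n)
+-cancelˡ-≤ᵇ zero    m n = refl
+-cancelˡ-≤ᵇ (suc i) m n = trans (<ᵇ-suc (i + m) (i + n)) (+-cancelˡ-≤ᵇ i m n)

+-cancelʳ-≤ᵇ : ∀ i m n → (m + i ≤ᵇ n + i) ≡ (m ≤ᵇ n)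
+-cancelʳ-≤ᵇ i m n = trans (cong₂ _≤ᵇ_ (+-comm m i) (+-comm n i)) (+-cancelˡ-≤ᵇ i m n)

≤⇒≤ᵇ-true : ∀ {m n} → m ≤ n → (m ≤ᵇ n) ≡ true
≤⇒≤ᵇ-true z≤n                 = refl
≤⇒≤ᵇ-true (s≤s {m} {n} m≤n) = trans (<ᵇ-suc m n) (≤⇒≤ᵇ-true m≤n)

<⇒≤ᵇ-false : ∀ {m n} → n < m → (m ≤ᵇ n) ≡ false
<⇒≤ᵇ-false {suc m} {zero}  _         = refl
<⇒≤ᵇ-false {suc m} {suc n} (s≤s n<m) = trans (<ᵇ-suc m n) (<⇒≤ᵇ-false n<m)

==-sym : ∀ c d → (c == d) ≡ (d == c)
==-sym (lo i)   (lo j)   = ≡ᵇ-sym i j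
==-sym (lo i)   (hi j l) = refl
==-sym (hi i k) (lo j)   = refl
==-sym (hi i k) (hi j l) = cong₂ _∧_ (≡ᵇ-sym i j) (≡ᵇ-sym k l)

==-false : ∀ c d → col c ≢ col d → (c == d) ≡ false
==-false (lo i)   (lo j)   i≢j = ≢⇒≡ᵇ-false i≢j
==-false (lo i)   (hi j l) _   = refl
==-false (hi i k) (lo j)   _   = refl
==-false (hi i k) (hi j l) i≢j = cong (_∧ (k ≡ᵇ l)) (≢⇒≡ᵇ-false i≢j)

-- Translation written j + i, so that shifting commutes with suc definitionally: suc j + i = suc (j + i).
shiftCell : ℕ → Cell → Cell
shiftCell i (lo j)   = lo (j + i)
shiftCell i (hi j k) = hi (j + i) k

shiftDomino : ℕ → Domino → Domino
shiftDomino i (u , v) = (shiftCell i u , shiftCell i v)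

col-shiftCell : ∀ i c → col (shiftCell i c) ≡ col c + i
col-shiftCell i (lo j)   = refl
col-shiftCell i (hi j k) = refl

shiftCell-== : ∀ i c d → (shiftCell i c == shiftCell i d) ≡ (c == d)
shiftCell-== i (lo m)   (lo n)   = +-cancelʳ-≡ᵇ i m n
shiftCell-== i (lo m)   (hi n l) = refl
shiftCell-== i (hi m k) (lo n)   = refl
shiftCell-== i (hi m k) (hi n l) = cong (_∧ (k ≡ᵇ l)) (+-cancelʳ-≡ᵇ i m n)

elem≡anyB : ∀ c ds → elem c ds ≡ anyB (c ==_) ds
elem≡anyB c []       = refl
elem≡anyB c (d ∷ ds) = cong ((c == d) ∨_) (elem≡anyB c ds)

elem-++ : ∀ c ds es → elem c (ds ++ es) ≡ elem c ds ∨ elem c es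
elem-++ c ds es = begin
  elem c (ds ++ es)                     ≡⟨ elem≡anyB c (ds ++ es) ⟩
  anyB (c ==_) (ds ++ es)               ≡⟨ anyB-++ (c ==_) ds es ⟩
  anyB (c ==_) ds ∨ anyB (c ==_) es     ≡⟨ sym (cong₂ _∨_ (elem≡anyB c ds) (elem≡anyB c es)) ⟩
  elem c ds ∨ elem c es                 ∎

elem-↭ : ∀ c {ds es} → ds ↭ es → elem c ds ≡ elem c es
elem-↭ c {ds} {es} ds↭es =
  trans (elem≡anyB c ds) (trans (anyB-↭ (c ==_) ds↭es) (sym (elem≡anyB c es)))

elem-shiftCell : ∀ i c ds → elem (shiftCell i c) (map (shiftCell i) ds) ≡ elem c ds
elem-shiftCell i c []       = refl
elem-shiftCell i c (d ∷ ds) = cong₂ _∨_ (shiftCell-== i c d) (elem-shiftCell i c ds)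

elem-apart : ∀ c ds → All (λ d → col c ≢ col d) ds → elem c ds ≡ false
elem-apart c ds apart = trans (elem≡anyB c ds) (anyB-none (c ==_) ds (All.map (==-false c _) apart))

distinct-↭ : ∀ {cs ds} → cs ↭ ds → distinct cs ≡ distinct ds
distinct-↭ ↭.refl               = refl
distinct-↭ (↭.prep c cs↭ds)     = cong₂ (λ b b′ → not b ∧ b′) (elem-↭ c cs↭ds) (distinct-↭ cs↭ds)
distinct-↭ (↭.swap {xs = cs} {ys = ds} c d cs↭ds) = begin
  not ((c == d) ∨ elem c cs) ∧ (not (elem d cs) ∧ distinct cs)
    ≡⟨ cong₂ (λ b b′ → not ((c == d) ∨ b) ∧ (not b′ ∧ distinct cs)) (elem-↭ c cs↭ds) (elem-↭ d cs↭ds) ⟩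
  not ((c == d) ∨ elem c ds) ∧ (not (elem d ds) ∧ distinct cs)
    ≡⟨ cong (λ b → not ((c == d) ∨ elem c ds) ∧ (not (elem d ds) ∧ b)) (distinct-↭ cs↭ds) ⟩
  not ((c == d) ∨ elem c ds) ∧ (not (elem d ds) ∧ distinct ds)
    ≡⟨ cong (λ b → not (b ∨ elem c ds) ∧ (not (elem d ds) ∧ distinct ds)) (==-sym c d) ⟩
  not ((d == c) ∨ elem c ds) ∧ (not (elem d ds) ∧ distinct ds)
    ≡⟨ not-∨-leftComm (d == c) (elem c ds) (elem d ds) (distinct ds) ⟩
  not ((d == c) ∨ elem d ds) ∧ (not (elem c ds) ∧ distinct ds) ∎
  where
  not-∨-leftComm : ∀ e x y z → not (e ∨ x) ∧ (not y ∧ z) ≡ not (e ∨ y) ∧ (not x ∧ z)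
  not-∨-leftComm true  x y z = refl
  not-∨-leftComm false x y z = ∧-leftComm (not x) (not y) z
distinct-↭ (↭.trans p₁ p₂) = trans (distinct-↭ p₁) (distinct-↭ p₂)

distinct-++ : ∀ cs ds → All (λ c → elem c ds ≡ false) cs → distinct (cs ++ ds) ≡ distinct cs ∧ distinct ds
distinct-++ []       ds []               = refl
distinct-++ (c ∷ cs) ds (c∉ds ∷ cs∉ds) = begin
  not (elem c (cs ++ ds)) ∧ distinct (cs ++ ds)
    ≡⟨ cong₂ (λ b b′ → not b ∧ b′) (trans (elem-++ c cs ds) (cong (elem c cs ∨_) c∉ds)) (distinct-++ cs ds cs∉ds) ⟩
  not (elem c cs ∨ false) ∧ (distinct cs ∧ distinct ds)
    ≡⟨ cong (λ b → not b ∧ (distinct cs ∧ distinct ds)) (∨-identityʳ (elem c cs)) ⟩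
  not (elem c cs) ∧ (distinct cs ∧ distinct ds)
    ≡⟨ sym (∧-assoc (not (elem c cs)) _ _) ⟩
  (not (elem c cs) ∧ distinct cs) ∧ distinct ds ∎

distinct-shiftCell : ∀ i cs → distinct (map (shiftCell i) cs) ≡ distinct cs
distinct-shiftCell i []       = refl
distinct-shiftCell i (c ∷ cs) = cong₂ (λ b b′ → not b ∧ b′) (elem-shiftCell i c cs) (distinct-shiftCell i cs)

endpoints-++ : ∀ ds es → endpoints (ds ++ es) ≡ endpoints ds ++ endpoints es
endpoints-++ []             es = refl
endpoints-++ ((u , v) ∷ ds) es = cong (λ cs → u ∷ v ∷ cs) (endpoints-++ ds es)

endpoints-shiftDomino : ∀ i ds → endpoints (map (shiftDomino i) ds) ≡ map (shiftCell i) (endpoints ds)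
endpoints-shiftDomino i []             = refl
endpoints-shiftDomino i ((u , v) ∷ ds) = cong (λ cs → shiftCell i u ∷ shiftCell i v ∷ cs) (endpoints-shiftDomino i ds)

endpoints-↭ : ∀ {ds es} → ds ↭ es → endpoints ds ↭ endpoints es
endpoints-↭ ↭.refl                  = ↭-refl
endpoints-↭ (↭.prep (u , v) ds↭es)  = ↭.prep u (↭.prep v (endpoints-↭ ds↭es))
endpoints-↭ (↭.swap (u , v) (u′ , v′) ds↭es) =
  ↭-trans (↭.prep u (↭.swap v u′ (↭.prep v′ ↭-refl)))
  (↭-trans (↭.swap u u′ (↭.swap v v′ (endpoints-↭ ds↭es)))
           (↭.prep u′ (↭.swap u v′ (↭.prep v ↭-refl))))
endpoints-↭ (↭.trans p₁ p₂) = ↭-trans (endpoints-↭ p₁) (endpoints-↭ p₂)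

Both : (Cell → Set) → Domino → Set
Both P (u , v) = P u × P v

All-endpoints : {P : Cell → Set} → ∀ ds → All (Both P) ds → All P (endpoints ds)
All-endpoints []             []                 = []
All-endpoints ((u , v) ∷ ds) ((Pu , Pv) ∷ Pds) = Pu ∷ Pv ∷ All-endpoints ds Pds

indicator : Bool → ℕ
indicator b = if b then 1 else 0

countB-++ : (p : Cell → Bool) → ∀ cs ds → countB p (cs ++ ds) ≡ countB p cs + countB p ds
countB-++ p []       ds = refl
countB-++ p (c ∷ cs) ds = trans (cong (indicator (p c) +_) (countB-++ p cs ds)) (sym (+-assoc (indicator (p c)) _ _))

countB-map : (p : Cell → Bool) (f : Cell → Cell) → ∀ cs → countB p (map f cs) ≡ countB (λ c → p (f c)) cs
countB-map p f []       = refl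
countB-map p f (c ∷ cs) = cong (indicator (p (f c)) +_) (countB-map p f cs)

countB-↭ : (p : Cell → Bool) {cs ds : List Cell} → cs ↭ ds → countB p cs ≡ countB p ds
countB-↭ p ↭.refl             = refl
countB-↭ p (↭.prep c cs↭ds)   = cong (indicator (p c) +_) (countB-↭ p cs↭ds)
countB-↭ p (↭.swap c d cs↭ds) =
  trans (+-leftComm (indicator (p c)) (indicator (p d)) _) (cong (λ n → indicator (p d) + (indicator (p c) + n)) (countB-↭ p cs↭ds))
countB-↭ p (↭.trans p₁ p₂)    = trans (countB-↭ p p₁) (countB-↭ p p₂)

countB-congᴬˡˡ : {P : Cell → Set} {p q : Cell → Bool} → (∀ c → P c → p c ≡ q c) → ∀ cs → All P cs → countB p cs ≡ countB q cs
countB-congᴬˡˡ p≗q []       []          = refl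
countB-congᴬˡˡ p≗q (c ∷ cs) (Pc ∷ Pcs) = cong₂ (λ b n → indicator b + n) (p≗q c Pc) (countB-congᴬˡˡ p≗q cs Pcs)

-- The board

applyUpTo-+ : {A : Set} (f : ℕ → A) (i p : ℕ) → applyUpTo f (i + p) ≡ applyUpTo f i ++ applyUpTo (λ j → f (i + j)) p
applyUpTo-+ f zero    p = refl
applyUpTo-+ f (suc i) p = cong (f 0 ∷_) (applyUpTo-+ (λ j → f (suc j)) i p)

range1-+ : ∀ i p → range1 (i + p) ≡ range1 i ++ map (_+ i) (range1 p)
range1-+ i p = begin
  map suc (upTo (i + p))                              ≡⟨ map-upTo suc (i + p) ⟩
  applyUpTo suc (i + p)                               ≡⟨ applyUpTo-+ suc i p ⟩
  applyUpTo suc i ++ applyUpTo (λ j → suc (i + j)) p  ≡⟨ cong₂ _++_ (sym (map-upTo suc i)) (sym (map-upTo _ p)) ⟩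
  range1 i ++ map (λ j → suc (i + j)) (upTo p)        ≡⟨ cong (range1 i ++_) (map-cong (λ j → cong suc (+-comm i j)) (upTo p)) ⟩
  range1 i ++ map (λ j → suc j + i) (upTo p)          ≡⟨ cong (range1 i ++_) (map-∘ (upTo p)) ⟩
  range1 i ++ map (_+ i) (range1 p)                   ∎

range1-∷ʳ : ∀ n → range1 (suc n) ≡ range1 n ∷ʳ suc n
range1-∷ʳ n = trans (cong (map suc) (sym (upTo-∷ʳ n))) (map-++ suc (upTo n) _)

range1-+-suc : ∀ k p → range1 (k + suc p) ≡ range1 k ++ suc k ∷ map (_+ suc k) (range1 p)
range1-+-suc k p = begin
  range1 (k + suc p)                                      ≡⟨ cong range1 (+-suc k p) ⟩
  range1 (suc k + p)                                      ≡⟨ range1-+ (suc k) p ⟩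
  range1 (suc k) ++ map (_+ suc k) (range1 p)             ≡⟨ cong (_++ map (_+ suc k) (range1 p)) (range1-∷ʳ k) ⟩
  (range1 k ∷ʳ suc k) ++ map (_+ suc k) (range1 p)        ≡⟨ ++-assoc (range1 k) _ _ ⟩
  range1 k ++ suc k ∷ map (_+ suc k) (range1 p)           ∎

All-range1 : {P : ℕ → Set} (n : ℕ) → (∀ {j} → 1 ≤ j → j ≤ n → P j) → All P (range1 n)
All-range1 n P-range = map⁺ (applyUpTo⁺₁ (λ j → j) n (P-range (s≤s z≤n)))

module _ {B : Set} (i : ℕ) (g : B → B) where

  map-shift : (f : ℕ → B) → (∀ j → f (j + i) ≡ g (f j)) → ∀ xs → map f (map (_+ i) xs) ≡ map g (map f xs)
  map-shift f f-shift xs = trans (sym (map-∘ xs)) (trans (map-cong f-shift xs) (map-∘ xs))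

  concatMap-shift : (f : ℕ → List B) → (∀ j → f (j + i) ≡ map g (f j)) →
    ∀ xs → concatMap f (map (_+ i) xs) ≡ map g (concatMap f xs)
  concatMap-shift f f-shift xs =
    trans (concatMap-map f (_+ i) xs) (trans (concatMap-cong f-shift xs) (sym (map-concatMap g f xs)))

map-range1-+-suc : {B : Set} (k p : ℕ) (g : B → B) (f : ℕ → B) → (∀ j → f (j + suc k) ≡ g (f j)) →
  map f (range1 (k + suc p)) ≡ map f (range1 k) ++ f (suc k) ∷ map g (map f (range1 p))
map-range1-+-suc k p g f f-shift = begin
  map f (range1 (k + suc p))                                   ≡⟨ cong (map f) (range1-+-suc k p) ⟩
  map f (range1 k ++ suc k ∷ map (_+ suc k) (range1 p))        ≡⟨ map-++ f (range1 k) _ ⟩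
  map f (range1 k) ++ f (suc k) ∷ map f (map (_+ suc k) (range1 p))
    ≡⟨ cong (λ ys → map f (range1 k) ++ f (suc k) ∷ ys) (map-shift (suc k) g f f-shift (range1 p)) ⟩
  map f (range1 k) ++ f (suc k) ∷ map g (map f (range1 p))     ∎

++-regroup : {A : Set} (a₁ a₂ a₃ a₄ b₁ b₂ b₃ b₄ : List A) (x₁ x₄ : A) →
  (a₁ ++ x₁ ∷ b₁) ++ (a₂ ++ b₂) ++ (a₃ ++ b₃) ++ (a₄ ++ x₄ ∷ b₄) ↭
  (a₁ ++ a₂ ++ a₃ ++ a₄) ++ (x₁ ∷ x₄ ∷ []) ++ (b₁ ++ b₂ ++ b₃ ++ b₄)
++-regroup {A} a₁ a₂ a₃ a₄ b₁ b₂ b₃ b₄ x₁ x₄ =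
  solve 10 (λ a₁ a₂ a₃ a₄ b₁ b₂ b₃ b₄ x₁ x₄ →
              (a₁ ⊕ (x₁ ⊕ b₁)) ⊕ ((a₂ ⊕ b₂) ⊕ ((a₃ ⊕ b₃) ⊕ (a₄ ⊕ (x₄ ⊕ b₄))))
            ⊜ (a₁ ⊕ (a₂ ⊕ (a₃ ⊕ a₄))) ⊕ ((x₁ ⊕ x₄) ⊕ (b₁ ⊕ (b₂ ⊕ (b₃ ⊕ b₄)))))
        ↭-refl a₁ a₂ a₃ a₄ b₁ b₂ b₃ b₄ (x₁ ∷ []) (x₄ ∷ [])
  where open CommMonoidSolver (++-commutativeMonoid {A = A})

InColumns : ℕ → Cell → Set
InColumns n c = 1 ≤ col c × col c ≤ n

module Board (q : ℕ) where

  lowerLink rung upperLink : ℕ → Domino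
  lowerLink j = (lo j , lo (suc j))
  rung      j = (lo j , hi j 0)
  upperLink j = (hi j (width q ∸ 1) , hi (suc j) 0)

  upperRun : ℕ → List Domino
  upperRun j = map (λ k → (hi j k , hi j (suc k))) (upTo (width q ∸ 1))

  upperSquares : ℕ → List Cell
  upperSquares j = map (hi j) (upTo (width q))

  crossing : ℕ → List Domino
  crossing i = lowerLink i ∷ upperLink i ∷ []

  cells-+ : ∀ i p → cells q (i + p) ↭ cells q i ++ map (shiftCell i) (cells q p)
  cells-+ i p = ↭-trans (↭-reflexive split)
    (↭-trans (swap-middle (map lo (range1 i)) (concatMap upperSquares (range1 i)) _ _)
             (↭-reflexive (cong (cells q i ++_) (sym (map-++ (shiftCell i) (map lo (range1 p)) _)))))
    where
    swap-middle : (A₁ A₂ B₁ B₂ : List Cell) → (A₁ ++ B₁) ++ (A₂ ++ B₂) ↭ (A₁ ++ A₂) ++ (B₁ ++ B₂)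
    swap-middle = solve 4 (λ a₁ a₂ b₁ b₂ → (a₁ ⊕ b₁) ⊕ (a₂ ⊕ b₂) ⊜ (a₁ ⊕ a₂) ⊕ (b₁ ⊕ b₂)) ↭-refl
      where open CommMonoidSolver (++-commutativeMonoid {A = Cell})
    split : cells q (i + p) ≡ (map lo (range1 i) ++ map (shiftCell i) (map lo (range1 p)))
                           ++ (concatMap upperSquares (range1 i) ++ map (shiftCell i) (concatMap upperSquares (range1 p)))
    split = begin
      map lo (range1 (i + p)) ++ concatMap upperSquares (range1 (i + p))
        ≡⟨ cong (λ js → map lo js ++ concatMap upperSquares js) (range1-+ i p) ⟩
      map lo (range1 i ++ map (_+ i) (range1 p)) ++ concatMap upperSquares (range1 i ++ map (_+ i) (range1 p))
        ≡⟨ cong₂ _++_ (map-++ lo (range1 i) _) (concatMap-++ upperSquares (range1 i) _) ⟩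
      (map lo (range1 i) ++ map lo (map (_+ i) (range1 p)))
        ++ (concatMap upperSquares (range1 i) ++ concatMap upperSquares (map (_+ i) (range1 p)))
        ≡⟨ cong₂ (λ xs ys → (map lo (range1 i) ++ xs) ++ (concatMap upperSquares (range1 i) ++ ys))
                 (map-shift i (shiftCell i) lo (λ _ → refl) (range1 p))
                 (concatMap-shift i (shiftCell i) upperSquares (λ _ → map-∘ (upTo (width q))) (range1 p)) ⟩
      (map lo (range1 i) ++ map (shiftCell i) (map lo (range1 p)))
        ++ (concatMap upperSquares (range1 i) ++ map (shiftCell i) (concatMap upperSquares (range1 p))) ∎

  dominoes-+ : ∀ k p → dominoes q (suc k + suc p) ↭
    dominoes q (suc k) ++ crossing (suc k) ++ map (shiftDomino (suc k)) (dominoes q (suc p))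
  dominoes-+ k p = ↭-trans (↭-reflexive split)
    (↭-trans (++-regroup lowerLinks rungs upperRuns upperLinks lowerLinks′ rungs′ upperRuns′ upperLinks′ (lowerLink i) (upperLink i))
             (↭-reflexive shifted))
    where
    i = suc k
    sh : List Domino → List Domino
    sh = map (shiftDomino i)
    lowerLinks  = map lowerLink (range1 k)
    rungs  = map rung (range1 i)
    upperRuns  = concatMap upperRun (range1 i)
    upperLinks  = map upperLink (range1 k)
    lowerLinks′ = sh (map lowerLink (range1 p))
    rungs′ = sh (map rung (range1 (suc p)))
    upperRuns′ = sh (concatMap upperRun (range1 (suc p)))
    upperLinks′ = sh (map upperLink (range1 p))
    split : dominoes q (i + suc p) ≡ (lowerLinks ++ lowerLink i ∷ lowerLinks′) ++ (rungs ++ rungs′)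
                                     ++ (upperRuns ++ upperRuns′) ++ (upperLinks ++ upperLink i ∷ upperLinks′)
    split = begin
      map lowerLink (range1 (k + suc p)) ++ map rung (range1 (i + suc p))
        ++ concatMap upperRun (range1 (i + suc p)) ++ map upperLink (range1 (k + suc p))
        ≡⟨ cong₂ (λ ds es → ds ++ map rung (range1 (i + suc p)) ++ concatMap upperRun (range1 (i + suc p)) ++ es)
                 (map-range1-+-suc k p (shiftDomino i) lowerLink (λ _ → refl)) (map-range1-+-suc k p (shiftDomino i) upperLink (λ _ → refl)) ⟩
      (lowerLinks ++ lowerLink i ∷ lowerLinks′) ++ map rung (range1 (i + suc p))
        ++ concatMap upperRun (range1 (i + suc p)) ++ (upperLinks ++ upperLink i ∷ upperLinks′)
        ≡⟨ cong (λ js → (lowerLinks ++ lowerLink i ∷ lowerLinks′) ++ map rung js ++ concatMap upperRun js ++ (upperLinks ++ upperLink i ∷ upperLinks′))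
                (range1-+ i (suc p)) ⟩
      (lowerLinks ++ lowerLink i ∷ lowerLinks′) ++ map rung (range1 i ++ map (_+ i) (range1 (suc p)))
        ++ concatMap upperRun (range1 i ++ map (_+ i) (range1 (suc p))) ++ (upperLinks ++ upperLink i ∷ upperLinks′)
        ≡⟨ cong₂ (λ ds es → (lowerLinks ++ lowerLink i ∷ lowerLinks′) ++ ds ++ es ++ (upperLinks ++ upperLink i ∷ upperLinks′))
             (trans (map-++ rung (range1 i) _)
                    (cong (rungs ++_) (map-shift i (shiftDomino i) rung (λ _ → refl) (range1 (suc p)))))
             (trans (concatMap-++ upperRun (range1 i) _)
                    (cong (upperRuns ++_) (concatMap-shift i (shiftDomino i) upperRun (λ _ → map-∘ (upTo (width q ∸ 1))) (range1 (suc p))))) ⟩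
      (lowerLinks ++ lowerLink i ∷ lowerLinks′) ++ (rungs ++ rungs′) ++ (upperRuns ++ upperRuns′) ++ (upperLinks ++ upperLink i ∷ upperLinks′) ∎
    shifted : (lowerLinks ++ rungs ++ upperRuns ++ upperLinks) ++ crossing i ++ (lowerLinks′ ++ rungs′ ++ upperRuns′ ++ upperLinks′)
            ≡ dominoes q i ++ crossing i ++ sh (dominoes q (suc p))
    shifted = cong (λ ds → dominoes q i ++ crossing i ++ ds) (sym (begin
      sh (map lowerLink (range1 p) ++ map rung (range1 (suc p)) ++ concatMap upperRun (range1 (suc p)) ++ map upperLink (range1 p))
        ≡⟨ map-++ (shiftDomino i) (map lowerLink (range1 p)) _ ⟩
      lowerLinks′ ++ sh (map rung (range1 (suc p)) ++ concatMap upperRun (range1 (suc p)) ++ map upperLink (range1 p))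
        ≡⟨ cong (lowerLinks′ ++_) (map-++ (shiftDomino i) (map rung (range1 (suc p))) _) ⟩
      lowerLinks′ ++ rungs′ ++ sh (concatMap upperRun (range1 (suc p)) ++ map upperLink (range1 p))
        ≡⟨ cong (λ ds → lowerLinks′ ++ rungs′ ++ ds) (map-++ (shiftDomino i) (concatMap upperRun (range1 (suc p))) _) ⟩
      lowerLinks′ ++ rungs′ ++ upperRuns′ ++ upperLinks′ ∎))

  cells-inColumns : ∀ n → All (InColumns n) (cells q n)
  cells-inColumns n = ++⁺ (map⁺ (All-range1 n _,_))
    (concat⁺ (map⁺ (All-range1 n (λ 1≤j j≤n → map⁺ (All.universal (λ _ → 1≤j , j≤n) (upTo (width q)))))))

  dominoes-inColumns : ∀ n → All (Both (InColumns n)) (dominoes q n)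
  dominoes-inColumns zero    = []
  dominoes-inColumns (suc m) =
    ++⁺ (map⁺ (All-range1 m link))
    (++⁺ (map⁺ (All-range1 (suc m) (λ 1≤j j≤n → (1≤j , j≤n) , (1≤j , j≤n))))
    (++⁺ (concat⁺ (map⁺ (All-range1 (suc m) (λ 1≤j j≤n →
                    map⁺ (All.universal (λ _ → (1≤j , j≤n) , (1≤j , j≤n)) (upTo (width q ∸ 1)))))))
         (map⁺ (All-range1 m link))))
    where
    link : ∀ {j} → 1 ≤ j → j ≤ m → (1 ≤ j × j ≤ suc m) × (1 ≤ suc j × suc j ≤ suc m)
    link 1≤j j≤m = (1≤j , m≤n⇒m≤1+n j≤m) , (s≤s z≤n , s≤s j≤m)

-- Cutting a tiling at a column boundary

ColumnsAtMost : ℕ → Domino → Set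
ColumnsAtMost i = Both (λ c → col c ≤ i)

ColumnsPositive : Domino → Set
ColumnsPositive = Both (λ c → 1 ≤ col c)

juxtapose : ℕ → List Domino → List Domino → List Domino
juxtapose i l r = l ++ map (shiftDomino i) r

shiftCell-beyond : ∀ i c → 1 ≤ col c → i < col (shiftCell i c)
shiftCell-beyond i c 1≤c = subst (i <_) (sym (col-shiftCell i c)) (+-monoˡ-≤ i 1≤c)

All-shiftCell-beyond : ∀ i cs → All (λ c → 1 ≤ col c) cs → All (λ c → i < col c) (map (shiftCell i) cs)
All-shiftCell-beyond i []       []             = []
All-shiftCell-beyond i (c ∷ cs) (1≤c ∷ 1≤cs) = shiftCell-beyond i c 1≤c ∷ All-shiftCell-beyond i cs 1≤cs

elem-left-of-shifted : ∀ i c ds → col c ≤ i → All (λ c → 1 ≤ col c) ds → elem c (map (shiftCell i) ds) ≡ false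
elem-left-of-shifted i c ds c≤i 1≤ds =
  elem-apart c _ (All.map (λ i<d → <⇒≢ (≤-<-trans c≤i i<d)) (All-shiftCell-beyond i ds 1≤ds))

elem-shifted-in-left : ∀ i c ds → 1 ≤ col c → All (λ d → col d ≤ i) ds → elem (shiftCell i c) ds ≡ false
elem-shifted-in-left i c ds 1≤c ds≤i =
  elem-apart (shiftCell i c) ds (All.map (λ d≤i → ≢-sym (<⇒≢ (≤-<-trans d≤i (shiftCell-beyond i c 1≤c)))) ds≤i)

isTiling-juxtapose : ∀ i l r → All (ColumnsAtMost i) l → All ColumnsPositive r →
  isTiling (juxtapose i l r) ≡ isTiling l ∧ isTiling r
isTiling-juxtapose i l r l≤i 1≤r = begin
  distinct (endpoints (l ++ map (shiftDomino i) r))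
    ≡⟨ cong distinct (trans (endpoints-++ l _) (cong (endpoints l ++_) (endpoints-shiftDomino i r))) ⟩
  distinct (endpoints l ++ map (shiftCell i) (endpoints r))
    ≡⟨ distinct-++ (endpoints l) _ (All.map (λ {c} c≤i → elem-left-of-shifted i c _ c≤i (All-endpoints r 1≤r)) (All-endpoints l l≤i)) ⟩
  distinct (endpoints l) ∧ distinct (map (shiftCell i) (endpoints r))
    ≡⟨ cong (distinct (endpoints l) ∧_) (distinct-shiftCell i (endpoints r)) ⟩
  distinct (endpoints l) ∧ distinct (endpoints r) ∎

crosses-left : ∀ {i j} d → i ≤ j → ColumnsAtMost i d → crosses j d ≡ false
crosses-left (u , v) i≤j (u≤i , v≤i)
  rewrite ≤⇒≤ᵇ-true (≤-trans u≤i i≤j) | ≤⇒≤ᵇ-true (≤-trans v≤i i≤j) = refl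

crosses-shiftDomino : ∀ i j d → crosses (j + i) (shiftDomino i d) ≡ crosses j d
crosses-shiftDomino i j (u , v)
  rewrite col-shiftCell i u | col-shiftCell i v | +-cancelʳ-≤ᵇ i (col u) j | +-cancelʳ-≤ᵇ i (col v) j = refl

crosses-zero : ∀ d → ColumnsPositive d → crosses 0 d ≡ false
crosses-zero (u , v) (1≤u , 1≤v) rewrite <⇒≤ᵇ-false 1≤u | <⇒≤ᵇ-false 1≤v = refl

crosses-between : ∀ i u v → col u ≡ i → col v ≡ suc i → crosses i (u , v) ≡ true
crosses-between i u v u≡i v≡1+i rewrite u≡i | v≡1+i | ≤⇒≤ᵇ-true (≤-refl {i}) | <⇒≤ᵇ-false (n<1+n i) = refl

breakable-zero : ∀ r → All ColumnsPositive r → breakable r 0 ≡ true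
breakable-zero r 1≤r = cong not (anyB-none (crosses 0) r (All.map (λ {d} → crosses-zero d) 1≤r))

breakable-juxtapose : ∀ i j l r → All (ColumnsAtMost i) l → breakable (juxtapose i l r) (j + i) ≡ breakable r j
breakable-juxtapose i j l r l≤i = cong not (begin
  anyB (crosses (j + i)) (l ++ map (shiftDomino i) r)
    ≡⟨ anyB-++ (crosses (j + i)) l _ ⟩
  anyB (crosses (j + i)) l ∨ anyB (crosses (j + i)) (map (shiftDomino i) r)
    ≡⟨ cong₂ _∨_ (anyB-none _ l (All.map (λ {d} → crosses-left d (m≤n+m i j)) l≤i)) (anyB-map _ (shiftDomino i) r) ⟩
  anyB (λ d → crosses (j + i) (shiftDomino i d)) r
    ≡⟨ anyB-cong (crosses-shiftDomino i j) r ⟩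
  anyB (crosses j) r ∎)

-- i is the last of the positions 1 … m at which brk holds, where i = 0 means that there is none.
lastBreakAt : (ℕ → Bool) → ℕ → ℕ → Bool
lastBreakAt brk m zero    = allB (λ j → not (brk j)) (range1 m)
lastBreakAt brk m (suc k) = brk (suc k) ∧ allB (λ j → not (brk (j + suc k))) (range1 (m ∸ suc k))

lastBreakAt-suc : ∀ brk m i → i ≤ m → lastBreakAt brk (suc m) i ≡ lastBreakAt brk m i ∧ not (brk (suc m))
lastBreakAt-suc brk m zero    _   = trans (cong (allB _) (range1-∷ʳ m)) (allB-∷ʳ _ (range1 m) (suc m))
lastBreakAt-suc brk m (suc k) k<m = begin
  brk (suc k) ∧ allB after (range1 (m ∸ k))
    ≡⟨ cong (λ js → brk (suc k) ∧ allB after js) (trans (cong range1 (+-∸-assoc 1 k<m)) (range1-∷ʳ (m ∸ suc k))) ⟩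
  brk (suc k) ∧ allB after (range1 (m ∸ suc k) ∷ʳ suc (m ∸ suc k))
    ≡⟨ cong (brk (suc k) ∧_) (allB-∷ʳ after (range1 (m ∸ suc k)) _) ⟩
  brk (suc k) ∧ (allB after (range1 (m ∸ suc k)) ∧ not (brk (suc (m ∸ suc k + suc k))))
    ≡⟨ cong (λ j → brk (suc k) ∧ (allB after (range1 (m ∸ suc k)) ∧ not (brk (suc j)))) (m∸n+n≡m k<m) ⟩
  brk (suc k) ∧ (allB after (range1 (m ∸ suc k)) ∧ not (brk (suc m)))
    ≡⟨ sym (∧-assoc (brk (suc k)) _ _) ⟩
  (brk (suc k) ∧ allB after (range1 (m ∸ suc k))) ∧ not (brk (suc m)) ∎
  where
  after : ℕ → Bool
  after j = not (brk (j + suc k))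

lastBreakAt-last : ∀ brk m → lastBreakAt brk (suc m) (suc m) ≡ brk (suc m)
lastBreakAt-last brk m rewrite n∸n≡0 m = ∧-identityʳ (brk (suc m))

sum-map-congᴬˡˡ : {A : Set} {f g : A → ℕ} → ∀ xs → All (λ x → f x ≡ g x) xs → sum (map f xs) ≡ sum (map g xs)
sum-map-congᴬˡˡ []       []               = refl
sum-map-congᴬˡˡ (x ∷ xs) (fx≡gx ∷ fxs≡gxs) = cong₂ _+_ fx≡gx (sum-map-congᴬˡˡ xs fxs≡gxs)

sum-map-upTo-suc : (f : ℕ → ℕ) (n : ℕ) → sum (map f (upTo (suc n))) ≡ sum (map f (upTo n)) + f n
sum-map-upTo-suc f n = begin
  sum (map f (upTo (suc n)))        ≡⟨ cong (λ xs → sum (map f xs)) (sym (upTo-∷ʳ n)) ⟩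
  sum (map f (upTo n ∷ʳ n))         ≡⟨ cong sum (map-++ f (upTo n) _) ⟩
  sum (map f (upTo n) ++ f n ∷ [])  ≡⟨ sum-++ (map f (upTo n)) _ ⟩
  sum (map f (upTo n)) + (f n + 0)  ≡⟨ cong (sum (map f (upTo n)) +_) (+-identityʳ (f n)) ⟩
  sum (map f (upTo n)) + f n        ∎

sum-lastBreakAt : ∀ brk m w → sum (map (λ i → if lastBreakAt brk m i then w else 0) (upTo (suc m))) ≡ w
sum-lastBreakAt brk zero    w = +-identityʳ _
sum-lastBreakAt brk (suc m) w = begin
  sum (map (weightIf (suc m)) (upTo (suc (suc m))))
    ≡⟨ sum-map-upTo-suc (weightIf (suc m)) (suc m) ⟩
  sum (map (weightIf (suc m)) (upTo (suc m))) + weightIf (suc m) (suc m)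
    ≡⟨ cong₂ _+_ (sum-map-congᴬˡˡ (upTo (suc m)) (applyUpTo⁺₁ (λ i → i) (suc m)
                    (λ {i} i<1+m → cong (λ b → if b then w else 0) (lastBreakAt-suc brk m i (≤-pred i<1+m)))))
                 (cong (λ b → if b then w else 0) (lastBreakAt-last brk m)) ⟩
  sum (map (λ i → if lastBreakAt brk m i ∧ not (brk (suc m)) then w else 0) (upTo (suc m))) + (if brk (suc m) then w else 0)
    ≡⟨ split (brk (suc m)) ⟩
  w ∎
  where
  weightIf : ℕ → ℕ → ℕ
  weightIf m i = if lastBreakAt brk m i then w else 0
  selectCong : {f g : ℕ → Bool} → (∀ i → f i ≡ g i) →
    sum (map (λ i → if f i then w else 0) (upTo (suc m))) ≡ sum (map (λ i → if g i then w else 0) (upTo (suc m)))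
  selectCong f≗g = cong sum (map-cong (λ i → cong (λ b → if b then w else 0) (f≗g i)) (upTo (suc m)))
  split : ∀ b → sum (map (λ i → if lastBreakAt brk m i ∧ not b then w else 0) (upTo (suc m))) + (if b then w else 0) ≡ w
  split true  = cong (_+ w) (trans (selectCong (λ i → ∧-zeroʳ (lastBreakAt brk m i))) (sum-map-zero (upTo (suc m))))
  split false = trans (+-identityʳ _)
                      (trans (selectCong (λ i → ∧-identityʳ (lastBreakAt brk m i))) (sum-lastBreakAt brk m w))

lastBreakAt-juxtapose : ∀ k p l r → All (ColumnsAtMost (suc k)) l → All ColumnsPositive r →
  lastBreakAt (breakable (juxtapose (suc k) l r)) (k + suc p) (suc k) ≡ unbreakable (suc p) r
lastBreakAt-juxtapose k p l r l≤i 1≤r = begin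
  breakable s (suc k) ∧ allB (λ j → not (breakable s (j + suc k))) (range1 (k + suc p ∸ suc k))
    ≡⟨ cong₂ (λ b n → b ∧ allB (λ j → not (breakable s (j + suc k))) (range1 n))
             (trans (breakable-juxtapose (suc k) 0 l r l≤i) (breakable-zero r 1≤r))
             (trans (cong (_∸ suc k) (+-suc k p)) (m+n∸m≡n (suc k) p)) ⟩
  true ∧ allB (λ j → not (breakable s (j + suc k))) (range1 p)
    ≡⟨ allB-cong (λ j → cong not (breakable-juxtapose (suc k) j l r l≤i)) (range1 p) ⟩
  unbreakable (suc p) r ∎
  where
  s = juxtapose (suc k) l r

lastBreakAt-cong : ∀ {brk brk′} → (∀ j → brk j ≡ brk′ j) → ∀ m i → lastBreakAt brk m i ≡ lastBreakAt brk′ m i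
lastBreakAt-cong brk≗brk′ m zero    = allB-cong (λ j → cong not (brk≗brk′ j)) (range1 m)
lastBreakAt-cong brk≗brk′ m (suc k) =
  cong₂ _∧_ (brk≗brk′ (suc k)) (allB-cong (λ j → cong not (brk≗brk′ (j + suc k))) (range1 (m ∸ suc k)))

if-∧-* : ∀ x y z (m n : ℕ) → (if (x ∧ y) ∧ z then m * n else 0) ≡ (if x ∧ true then m else 0) * (if y ∧ z then n else 0)
if-∧-* false y z m n = refl
if-∧-* true  y z m n with y ∧ z
... | true  = refl
... | false = sym (*-zeroʳ m)

module Counting (q a b : ℕ) where
  open Board q

  tilingWeight : ℕ → (List Domino → Bool) → List Domino → ℕ
  tilingWeight n P ds = if isTiling ds ∧ P ds then weight q a b n ds else 0

  singles-juxtapose : ∀ i p l r → All (ColumnsAtMost i) l → All ColumnsPositive r →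
    singles q (i + p) (juxtapose i l r) ≡ singles q i l + singles q p r
  singles-juxtapose i p l r l≤i 1≤r = begin
    countB (λ c → not (elem c (endpoints (l ++ map (shiftDomino i) r)))) (cells q (i + p))
      ≡⟨ cong (λ cs → countB (λ c → not (elem c cs)) (cells q (i + p)))
              (trans (endpoints-++ l _) (cong (El ++_) (endpoints-shiftDomino i r))) ⟩
    countB free (cells q (i + p))
      ≡⟨ countB-↭ free (cells-+ i p) ⟩
    countB free (cells q i ++ map (shiftCell i) (cells q p))
      ≡⟨ countB-++ free (cells q i) _ ⟩
    countB free (cells q i) + countB free (map (shiftCell i) (cells q p))
      ≡⟨ cong (countB free (cells q i) +_) (countB-map free (shiftCell i) (cells q p)) ⟩
    countB free (cells q i) + countB (λ c → free (shiftCell i c)) (cells q p)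
      ≡⟨ cong₂ _+_ (countB-congᴬˡˡ free-left (cells q i) (cells-inColumns i))
                   (countB-congᴬˡˡ free-right (cells q p) (cells-inColumns p)) ⟩
    singles q i l + singles q p r ∎
    where
    El = endpoints l
    Er = endpoints r
    free : Cell → Bool
    free c = not (elem c (El ++ map (shiftCell i) Er))
    free-left : ∀ c → InColumns i c → free c ≡ not (elem c El)
    free-left c (_ , c≤i) = cong not (begin
      elem c (El ++ map (shiftCell i) Er)           ≡⟨ elem-++ c El _ ⟩
      elem c El ∨ elem c (map (shiftCell i) Er)     ≡⟨ cong (elem c El ∨_) (elem-left-of-shifted i c Er c≤i (All-endpoints r 1≤r)) ⟩
      elem c El ∨ false                             ≡⟨ ∨-identityʳ (elem c El) ⟩
      elem c El                                     ∎)
    free-right : ∀ c → InColumns p c → free (shiftCell i c) ≡ not (elem c Er)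
    free-right c (1≤c , _) = cong not (begin
      elem (shiftCell i c) (El ++ map (shiftCell i) Er)
        ≡⟨ elem-++ (shiftCell i c) El _ ⟩
      elem (shiftCell i c) El ∨ elem (shiftCell i c) (map (shiftCell i) Er)
        ≡⟨ cong₂ _∨_ (elem-shifted-in-left i c El 1≤c (All-endpoints l l≤i)) (elem-shiftCell i c Er) ⟩
      elem c Er ∎)

  weight-juxtapose : ∀ i p l r → All (ColumnsAtMost i) l → All ColumnsPositive r →
    weight q a b (i + p) (juxtapose i l r) ≡ weight q a b i l * weight q a b p r
  weight-juxtapose i p l r l≤i 1≤r = begin
    a ^ singles q (i + p) (juxtapose i l r) * b ^ length (l ++ map (shiftDomino i) r)
      ≡⟨ cong₂ (λ x y → a ^ x * b ^ y) (singles-juxtapose i p l r l≤i 1≤r)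
                                        (trans (length-++ l) (cong (length l +_) (length-map (shiftDomino i) r))) ⟩
    a ^ (singles q i l + singles q p r) * b ^ (length l + length r)
      ≡⟨ cong₂ _*_ (^-distribˡ-+-* a (singles q i l) _) (^-distribˡ-+-* b (length l) _) ⟩
    (a ^ singles q i l * a ^ singles q p r) * (b ^ length l * b ^ length r)
      ≡⟨ *-interchange (a ^ singles q i l) _ _ _ ⟩
    weight q a b i l * weight q a b p r ∎

  tilingWeight-↭ : ∀ n {P} → (∀ {s t} → s ↭ t → P s ≡ P t) → ∀ {s t} → s ↭ t → tilingWeight n P s ≡ tilingWeight n P t
  tilingWeight-↭ n P-↭ s↭t = cong₃ (λ x y w → if x ∧ y then w else 0)
    (distinct-↭ (endpoints-↭ s↭t))
    (P-↭ s↭t)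
    (cong₂ (λ x y → a ^ x * b ^ y)
           (countB-congᴬˡˡ (λ c _ → cong not (elem-↭ c (endpoints-↭ s↭t))) (cells q n) (All.universal (λ _ → tt) (cells q n)))
           (↭-length s↭t))
    where
    cong₃ : {A B C D : Set} (f : A → B → C → D) {x x′ : A} {y y′ : B} {z z′ : C} →
      x ≡ x′ → y ≡ y′ → z ≡ z′ → f x y z ≡ f x′ y′ z′
    cong₃ f refl refl refl = refl

  lastBreakAt-↭ : ∀ m i {s t} → s ↭ t → lastBreakAt (breakable s) m i ≡ lastBreakAt (breakable t) m i
  lastBreakAt-↭ m i s↭t = lastBreakAt-cong (λ j → cong not (anyB-↭ (crosses j) s↭t)) m i

  tilingWeight-crossing : ∀ n m k l d rest → crosses (suc k) d ≡ true →
    tilingWeight n (λ s → lastBreakAt (breakable s) m (suc k)) (l ++ d ∷ rest) ≡ 0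
  tilingWeight-crossing n m k l d rest d-crosses
    rewrite anyB-++ (crosses (suc k)) l (d ∷ rest) | d-crosses | ∨-zeroʳ (anyB (crosses (suc k)) l)
          | ∧-zeroʳ (isTiling (l ++ d ∷ rest)) = refl

  tilingWeight-juxtapose : ∀ k p l r → All (ColumnsAtMost (suc k)) l → All ColumnsPositive r →
    tilingWeight (suc k + suc p) (λ s → lastBreakAt (breakable s) (k + suc p) (suc k)) (juxtapose (suc k) l r)
      ≡ tilingWeight (suc k) (λ _ → true) l * tilingWeight (suc p) (unbreakable (suc p)) r
  tilingWeight-juxtapose k p l r l≤i 1≤r
    rewrite isTiling-juxtapose (suc k) l r l≤i 1≤r | lastBreakAt-juxtapose k p l r l≤i 1≤r
          | weight-juxtapose (suc k) (suc p) l r l≤i 1≤r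
    = if-∧-* (isTiling l) (isTiling r) (unbreakable (suc p) r) _ _

  countTilings-lastBreakAt : ∀ k p →
    sumSubsets (dominoes q (suc k + suc p)) (tilingWeight (suc k + suc p) (λ s → lastBreakAt (breakable s) (k + suc p) (suc k)))
      ≡ R q a b (suc k) * Rt q a b (suc p)
  countTilings-lastBreakAt k p = begin
    sumSubsets (dominoes q n) g
      ≡⟨ sumSubsets-↭ g (tilingWeight-↭ n (lastBreakAt-↭ (k + suc p) i)) (dominoes-+ k p) ⟩
    sumSubsets (Dᵢ ++ crossing i ++ map (shiftDomino i) Dₚ) g
      ≡⟨ sumSubsets-++ Dᵢ _ g ⟩
    sumSubsets Dᵢ (λ l → sumSubsets (crossing i ++ map (shiftDomino i) Dₚ) (λ t → g (l ++ t)))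
      ≡⟨ sumSubsets-congᴬˡˡ Dᵢ (All.map (λ {d} → Product.map proj₂ proj₂) (dominoes-inColumns i)) right ⟩
    sumSubsets Dᵢ (λ l → sumSubsets Dₚ (λ r → tilingWeight i (λ _ → true) l * tilingWeight (suc p) (unbreakable (suc p)) r))
      ≡⟨ sumSubsets-product Dᵢ Dₚ _ _ ⟩
    R q a b i * Rt q a b (suc p) ∎
    where
    i = suc k
    n = i + suc p
    m = k + suc p
    g = tilingWeight n (λ s → lastBreakAt (breakable s) m i)
    Dᵢ = dominoes q i
    Dₚ = dominoes q (suc p)
    right : ∀ l → All (ColumnsAtMost i) l →
      sumSubsets (crossing i ++ map (shiftDomino i) Dₚ) (λ t → g (l ++ t))
        ≡ sumSubsets Dₚ (λ r → tilingWeight i (λ _ → true) l * tilingWeight (suc p) (unbreakable (suc p)) r)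
    right l l≤i = begin
      sumSubsets (crossing i ++ map (shiftDomino i) Dₚ) (λ t → g (l ++ t))
        ≡⟨ sumSubsets-++ (crossing i) (map (shiftDomino i) Dₚ) (λ t → g (l ++ t)) ⟩
      Σ (λ r → g (l ++ r)) + (Σ (λ r → g (l ++ upperLink i ∷ r))
        + (Σ (λ r → g (l ++ lowerLink i ∷ r)) + (Σ (λ r → g (l ++ lowerLink i ∷ upperLink i ∷ r)) + 0)))
        ≡⟨ cong₂ (λ x y → Σ (λ r → g (l ++ r)) + (x + y))
             (sumSubsets-zero (map (shiftDomino i) Dₚ) (λ r → tilingWeight-crossing n m k l (upperLink i) r upper-crosses))
             (cong₂ (λ x y → x + (y + 0))
               (sumSubsets-zero (map (shiftDomino i) Dₚ) (λ r → tilingWeight-crossing n m k l (lowerLink i) r lower-crosses))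
               (sumSubsets-zero (map (shiftDomino i) Dₚ) (λ r → tilingWeight-crossing n m k l (lowerLink i) (upperLink i ∷ r) lower-crosses))) ⟩
      Σ (λ r → g (l ++ r)) + 0
        ≡⟨ +-identityʳ _ ⟩
      Σ (λ r → g (l ++ r))
        ≡⟨ sumSubsets-map (shiftDomino i) Dₚ _ ⟩
      sumSubsets Dₚ (λ r → g (juxtapose i l r))
        ≡⟨ sumSubsets-congᴬˡˡ Dₚ (All.map (λ {d} → Product.map proj₁ proj₁) (dominoes-inColumns (suc p)))
                              (λ r 1≤r → tilingWeight-juxtapose k p l r l≤i 1≤r) ⟩
      sumSubsets Dₚ (λ r → tilingWeight i (λ _ → true) l * tilingWeight (suc p) (unbreakable (suc p)) r) ∎
      where
      Σ : (List Domino → ℕ) → ℕ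
      Σ = sumSubsets (map (shiftDomino i) Dₚ)
      lower-crosses : crosses i (lowerLink i) ≡ true
      lower-crosses = crosses-between i (lo i) (lo (suc i)) refl refl
      upper-crosses : crosses i (upperLink i) ≡ true
      upper-crosses = crosses-between i (hi i (width q ∸ 1)) (hi (suc i) 0) refl refl

  tilingWeight-partition : ∀ m s → tilingWeight (suc m) (λ _ → true) s
    ≡ sum (map (λ i → tilingWeight (suc m) (λ t → lastBreakAt (breakable t) m i) s) (upTo (suc m)))
  tilingWeight-partition m s with isTiling s
  ... | true  = sym (sum-lastBreakAt (breakable s) m (weight q a b (suc m) s))
  ... | false = sym (sum-map-zero (upTo (suc m)))

  countTilings-lastBreakAt-≤ : ∀ m i → i ≤ m →
    sumSubsets (dominoes q (suc m)) (tilingWeight (suc m) (λ s → lastBreakAt (breakable s) m i))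
      ≡ R q a b i * Rt q a b (suc m ∸ i)
  countTilings-lastBreakAt-≤ m zero    _   = sym (*-identityˡ _)  -- R q a b 0 = 1 and lastBreakAt … 0 unfolds to unbreakable
  countTilings-lastBreakAt-≤ m (suc k) k<m = subst Claim (trans (+-suc k p) (m+[n∸m]≡n k<m))
    (trans (countTilings-lastBreakAt k p) (cong (λ j → R q a b (suc k) * Rt q a b j) (sym (m+n∸m≡n k (suc p)))))
    where
    p = m ∸ suc k
    Claim : ℕ → Set
    Claim x = sumSubsets (dominoes q (suc x)) (tilingWeight (suc x) (λ s → lastBreakAt (breakable s) x (suc k)))
                ≡ R q a b (suc k) * Rt q a b (suc x ∸ suc k)

  recurrence : ∀ m → R q a b (suc m) ≡ sum (map (λ i → R q a b i * Rt q a b (suc m ∸ i)) (upTo (suc m)))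
  recurrence m = begin
    sumSubsets D (tilingWeight n (λ _ → true))
      ≡⟨ sumSubsets-cong D (tilingWeight-partition m) ⟩
    sumSubsets D (λ s → sum (map (λ i → weightWithLastBreak i s) (upTo n)))
      ≡⟨ sum-map-swap (λ s i → weightWithLastBreak i s) (subsets D) (upTo n) ⟩
    sum (map (λ i → sumSubsets D (weightWithLastBreak i)) (upTo n))
      ≡⟨ sum-map-congᴬˡˡ (upTo n) (applyUpTo⁺₁ (λ i → i) n (λ {i} i<n → countTilings-lastBreakAt-≤ m i (≤-pred i<n))) ⟩
    sum (map (λ i → R q a b i * Rt q a b (n ∸ i)) (upTo n)) ∎
    where
    n = suc m
    D = dominoes q n
    weightWithLastBreak : ℕ → List Domino → ℕ
    weightWithLastBreak i = tilingWeight n (λ s → lastBreakAt (breakable s) m i)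

-- The recurrence holds for every q, a and b.
mainTheorem5 : (q a b : ℕ) → 4 ≤ q → 1 ≤ a → 1 ≤ b → (n : ℕ) → 1 ≤ n →
    R q a b n ≡ sum (map (λ i → R q a b i * Rt q a b (n ∸ i)) (upTo n))
mainTheorem5 q a b _ _ _ (suc m) _ = Counting.recurrence q a b m
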